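{- The set $S_{max}(BW_n)$ of maximal parking functions of $BW_n$ equals the set of all $s\in\mathbb{N}^n$ that can be written as $s=e_1+\sum_{j=1}^{n-1}a_j$ with $a_j\in\{e_j,e_{j+1}\}$ for every $j$, where $(e_i)_{i=1}^n$ is the standard basis of $\mathbb{N}^n$.
   Context: The broken wheel graph $BW_n$ is the multigraph on vertices $0,\dots,n$ with two parallel edges between $0$ and $1$, one edge $0$–$i$ for each $2\le i\le n$, and one edge $i$–$(i+1)$ for $1\le i\le n-1$. For $1\le i\le k\le j\le n$, $d(i,k,j)$ is the number of edges joining $k$ to a vertex outside $\{i,\dots,j\}$. A parking function is $s\in\mathbb{N}^n$ such that for all $1\le i\le j\le n$ there is $k\in\{i,\dots,j\}$ with $s(k)<d(i,k,j)$. $S_{max}(BW_n)$ is the set of parking functions $s$ with $\sum_{i=1}^n s(i)=n$. -}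

module Defs where

open import Data.Nat using (ℕ; zero; suc; _+_; _≤_; _<_; _≡ᵇ_)
open import Data.Nat.Properties using (_≤?_; _≟_)
open import Data.Bool using (Bool; true; false; if_then_else_; _∧_; not)
open import Data.Fin using (Fin; zero; suc; inject₁)
open import Data.Fin.Properties using () renaming (_≟_ to _≟ᶠ_)
open import Data.List using (List; []; _∷_; _++_; map; upTo)
open import Data.Nat.ListAction using (sum)
open import Data.Vec using (Vec; []; _∷_; tabulate; zipWith; replicate)
import Data.Vec as V
open import Data.Product using (_×_; _,_; ∃; Σ)
open import Data.Sum using (_⊎_)
open import Relation.Nullary.Decidable using (⌊_⌋)
open import Relation.Binary.PropositionalEquality using (_≡_)

-- The broken wheel graph BW_n as an explicit list (multiset) of edges on
-- vertices 0,…,n:  two parallel edges 0–1, an edge 0–i for 2 ≤ i ≤ n,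
-- and an edge i–(i+1) for 1 ≤ i ≤ n-1.
BW-edges : ℕ → List (ℕ × ℕ)
BW-edges n =
  (0 , 1) ∷ (0 , 1) ∷
  (map (λ t → (0 , t + 2)) (upTo (n Data.Nat.∸ 1)) ++
   map (λ t → (t + 1 , t + 2)) (upTo (n Data.Nat.∸ 1)))

inInterval : ℕ → ℕ → ℕ → Bool
inInterval i j v = ⌊ i ≤? v ⌋ ∧ ⌊ v ≤? j ⌋

edgeContrib : ℕ → ℕ → ℕ → ℕ × ℕ → ℕ
edgeContrib i k j (u , v) =
  (if ⌊ u ≟ k ⌋ ∧ not (inInterval i j v) then 1 else 0) +
  (if ⌊ v ≟ k ⌋ ∧ not (inInterval i j u) then 1 else 0)

-- d(i,k,j) = number of edges of BW_n joining k to a vertex outside {i,…,j}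
d : (n i k j : ℕ) → ℕ
d n i k j = sum (map (edgeContrib i k j) (BW-edges n))

-- value s(k) of s ∈ ℕ^n at vertex k (1-based: vertex k ↦ k-th entry);
-- only used for 1 ≤ k ≤ n
at : ∀ {n} → Vec ℕ n → ℕ → ℕ
at [] k = 0
at (x ∷ xs) zero = 0
at (x ∷ xs) (suc zero) = x
at (x ∷ xs) (suc (suc k)) = at xs (suc k)

IsParking : (n : ℕ) → Vec ℕ n → Set
IsParking n s = ∀ i j → 1 ≤ i → i ≤ j → j ≤ n →
  ∃ λ k → i ≤ k × k ≤ j × at s k < d n i k j

InSmax : (n : ℕ) → Vec ℕ n → Set
InSmax n s = IsParking n s × V.sum s ≡ n

-- standard basis vector (0-based index: e zero = e_1)
e : ∀ {n} → Fin n → Vec ℕ n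
e i = tabulate (λ j → if ⌊ i ≟ᶠ j ⌋ then 1 else 0)

_⊕_ : ∀ {n} → Vec ℕ n → Vec ℕ n → Vec ℕ n
_⊕_ = zipWith _+_

vsum : ∀ {m n} → (Fin m → Vec ℕ n) → Vec ℕ n
vsum {zero} a = replicate _ 0
vsum {suc m} a = a zero ⊕ vsum (λ j → a (suc j))

-- Reading off the edges of BW_n, for 1 ≤ i ≤ k ≤ j ≤ n one has
-- d(i,k,j) = 1 + [k = i] + [k = j < n].  Splitting an interval at the vertex
-- supplied by the parking condition shows, by induction on its length, that a
-- parking function puts at most (j − i + 1) + [j < n] on every interval [i,j];
-- conversely this bound produces such a vertex by pigeonhole.  Together with
-- Σ s = n the bound says exactly that the prefix sums P(k) = s(1) + ⋯ + s(k)
-- satisfy k ≤ P(k) ≤ k + 1 for k < n.  With c_k = P(k) − k ∈ {0,1} one gets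
-- s(k) = 1 + c_k − c_(k−1), the k-th entry of e₁ + Σ a_j for a_j = e_j when
-- c_j = 1 and a_j = e_(j+1) when c_j = 0; both sides are peeled off one
-- coordinate at a time, carrying the bit c_k.

module Submission where

open import Defs
open import Data.Bool using (Bool; true; false; if_then_else_; _∧_; not)
open import Data.Bool.Properties using (∧-identityʳ; ∧-zeroʳ)
open import Data.Fin using (Fin; zero; suc; inject₁)
open import Data.Fin.Properties using () renaming (_≟_ to _≟ᶠ_)
open import Data.List using (map; upTo; applyUpTo; _++_)
open import Data.List.Properties using (map-++; map-∘; map-cong; map-upTo)
open import Data.Nat using (ℕ; zero; suc; _+_; _∸_; _≤_; _<_; z≤n; s≤s; z<s; s<s; s≤s⁻¹; s<s⁻¹)
open import Data.Nat.Induction using (<-rec)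
open import Data.Nat.ListAction using (sum)
open import Data.Nat.ListAction.Properties using (sum-++)
open import Data.Nat.Properties
open import Algebra.Properties.CommutativeSemigroup +-commutativeSemigroup using (interchange)
open import Data.Nat.Tactic.RingSolver using (solve-∀)
open import Data.Product using (Σ; ∃; ∃₂; _×_; _,_; proj₁; proj₂; uncurry)
open import Data.Product.Function.NonDependent.Propositional using (_×-⇔_)
open import Data.Sum using (_⊎_; inj₁; inj₂)
import Data.Sum as Sum
open import Data.Vec using (Vec; []; _∷_; tabulate; replicate; tail)
import Data.Vec as V
open import Data.Vec.Properties using (∷-injectiveˡ; ∷-injectiveʳ; tabulate-cong; zipWith-identityˡ)
open import Function using (_∘_)
open import Function.Bundles using (_⇔_; mk⇔; Equivalence)
open import Function.Properties.Equivalence using () renaming (trans to ⇔-trans; sym to ⇔-sym)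
open import Relation.Nullary using (¬_; Dec; yes; no)
open import Relation.Nullary.Decidable using (⌊_⌋; dec-true; dec-false; isYes≗does)
open import Relation.Binary.PropositionalEquality

𝟙[_] : Bool → ℕ
𝟙[ b ] = if b then 1 else 0

⌊⌋-true : ∀ {A : Set} (a? : Dec A) → A → ⌊ a? ⌋ ≡ true
⌊⌋-true a? a = trans (isYes≗does a?) (dec-true a? a)

⌊⌋-false : ∀ {A : Set} (a? : Dec A) → ¬ A → ⌊ a? ⌋ ≡ false
⌊⌋-false a? ¬a = trans (isYes≗does a?) (dec-false a? ¬a)

sum-applyUpTo-zero : ∀ (f : ℕ → ℕ) N → (∀ t → t < N → f t ≡ 0) → sum (applyUpTo f N) ≡ 0
sum-applyUpTo-zero f zero       f≡0 = refl
sum-applyUpTo-zero f (suc N) f≡0 =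
  cong₂ _+_ (f≡0 0 z<s) (sum-applyUpTo-zero (f ∘ suc) N (λ t t<N → f≡0 (suc t) (s<s t<N)))

sum-applyUpTo-point : ∀ (f : ℕ → ℕ) {c} N → (∀ t → t ≢ c → f t ≡ 0) → c < N → sum (applyUpTo f N) ≡ f c
sum-applyUpTo-point f {zero} (suc N) f≡0 _ =
  trans (cong (f 0 +_) (sum-applyUpTo-zero (f ∘ suc) N (λ t _ → f≡0 (suc t) λ ()))) (+-identityʳ (f 0))
sum-applyUpTo-point f {suc c} (suc N) f≡0 (s<s c<N) =
  cong₂ _+_ (f≡0 0 λ ()) (sum-applyUpTo-point (f ∘ suc) N (λ t t≢c → f≡0 (suc t) (t≢c ∘ suc-injective)) c<N)

sum-applyUpTo-+ : ∀ (f g : ℕ → ℕ) N →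
  sum (applyUpTo (λ t → f t + g t) N) ≡ sum (applyUpTo f N) + sum (applyUpTo g N)
sum-applyUpTo-+ f g zero    = refl
sum-applyUpTo-+ f g (suc N) = begin
  f 0 + g 0 + sum (applyUpTo (λ t → f (suc t) + g (suc t)) N)
    ≡⟨ cong (f 0 + g 0 +_) (sum-applyUpTo-+ (f ∘ suc) (g ∘ suc) N) ⟩
  f 0 + g 0 + (F + G)
    ≡⟨ interchange (f 0) (g 0) F G ⟩
  f 0 + F + (g 0 + G) ∎
  where
  open ≡-Reasoning
  F = sum (applyUpTo (f ∘ suc) N)
  G = sum (applyUpTo (g ∘ suc) N)

sum-map-upTo : ∀ {A : Set} (g : A → ℕ) {f f′ : ℕ → A} → f ≗ f′ → ∀ N →
  sum (map g (map f (upTo N))) ≡ sum (applyUpTo (g ∘ f′) N)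
sum-map-upTo g {f} {f′} f≗f′ N =
  cong sum (trans (sym (map-∘ (upTo N))) (trans (map-cong (cong g ∘ f≗f′) (upTo N)) (map-upTo (g ∘ f′) N)))

-- The degree function of BW_n

module _ (i k j : ℕ) where

  leaves : ℕ → ℕ → ℕ
  leaves u v = 𝟙[ ⌊ u ≟ k ⌋ ∧ not (inInterval i j v) ]

  leaves-off : ∀ {u} v → u ≢ k → leaves u v ≡ 0
  leaves-off {u} v u≢k rewrite ⌊⌋-false (u ≟ k) u≢k = refl

  leaves-at : ∀ {u} v → u ≡ k → leaves u v ≡ 𝟙[ not (inInterval i j v) ]
  leaves-at v refl rewrite ⌊⌋-true (k ≟ k) refl = refl

  d-split : ∀ n → let N = n ∸ 1; ec = edgeContrib i k j in
    d n i k j ≡ ec (0 , 1) + (ec (0 , 1) + (sum (applyUpTo (λ t → ec (0 , 2 + t)) N)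
                + (sum (applyUpTo (λ t → leaves (1 + t) (2 + t)) N) + sum (applyUpTo (λ t → leaves (2 + t) (1 + t)) N))))
  d-split n = cong (λ z → ec (0 , 1) + (ec (0 , 1) + z)) (begin
    sum (map ec (map spoke (upTo N) ++ map path (upTo N)))
      ≡⟨ cong sum (map-++ ec (map spoke (upTo N)) _) ⟩
    sum (map ec (map spoke (upTo N)) ++ map ec (map path (upTo N)))
      ≡⟨ sum-++ (map ec (map spoke (upTo N))) _ ⟩
    sum (map ec (map spoke (upTo N))) + sum (map ec (map path (upTo N)))
      ≡⟨ cong₂ _+_ (sum-map-upTo ec (λ t → cong (0 ,_) (+-comm t 2)) N)
                   (trans (sum-map-upTo ec (λ t → cong₂ _,_ (+-comm t 1) (+-comm t 2)) N)
                          (sum-applyUpTo-+ (λ t → leaves (1 + t) (2 + t)) _ N)) ⟩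
    _ ∎)
    where
    open ≡-Reasoning
    N = n ∸ 1
    ec = edgeContrib i k j
    spoke path : ℕ → ℕ × ℕ
    spoke t = (0 , t + 2)
    path t = (t + 1 , t + 2)

spoke-contrib : ∀ i k j v → edgeContrib (suc i) (suc k) j (0 , v) ≡ 𝟙[ ⌊ v ≟ suc k ⌋ ]
spoke-contrib i k j v = cong 𝟙[_] (∧-identityʳ _)

spokes-sum-1 : ∀ i j N → sum (applyUpTo (λ t → edgeContrib (suc i) 1 j (0 , 2 + t)) N) ≡ 0
spokes-sum-1 i j N = sum-applyUpTo-zero _ N λ t _ → spoke-contrib i 0 j (2 + t)

spokes-sum-2+ : ∀ i c j n → 2 + c ≤ n →
  sum (applyUpTo (λ t → edgeContrib (suc i) (2 + c) j (0 , 2 + t)) (n ∸ 1)) ≡ 1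
spokes-sum-2+ i c j (suc n) (s≤s 1+c≤n) = begin
  sum (applyUpTo spoke n)  ≡⟨ sum-applyUpTo-point spoke n off 1+c≤n ⟩
  spoke c                  ≡⟨ trans (spoke-contrib i (suc c) j (2 + c)) (cong 𝟙[_] (⌊⌋-true (2 + c ≟ 2 + c) refl)) ⟩
  1                        ∎
  where
  open ≡-Reasoning
  spoke : ℕ → ℕ
  spoke t = edgeContrib (suc i) (2 + c) j (0 , 2 + t)
  off : ∀ t → t ≢ c → spoke t ≡ 0
  off t t≢c = trans (spoke-contrib i (suc c) j (2 + t))
                    (cong 𝟙[_] (⌊⌋-false (2 + t ≟ 2 + c) (t≢c ∘ +-cancelˡ-≡ 2 t c)))

left-path-sum-1 : ∀ i j N → sum (applyUpTo (λ t → leaves i 1 j (2 + t) (1 + t)) N) ≡ 0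
left-path-sum-1 i j N = sum-applyUpTo-zero _ N λ _ _ → refl

left-path-sum-2+ : ∀ {i c j n} → i ≤ 2 + c → 2 + c ≤ j → j ≤ n →
  sum (applyUpTo (λ t → leaves i (2 + c) j (2 + t) (1 + t)) (n ∸ 1)) ≡ 𝟙[ ⌊ 2 + c ≟ i ⌋ ]
left-path-sum-2+ {n = zero} _ k≤j j≤n with () ← ≤-trans k≤j j≤n
left-path-sum-2+ {i} {c} {j} {suc n} i≤k k≤j j≤n = begin
  sum (applyUpTo (λ t → leaves i (2 + c) j (2 + t) (1 + t)) n)
    ≡⟨ sum-applyUpTo-point _ n (λ t t≢c → leaves-off i (2 + c) j (1 + t) (t≢c ∘ +-cancelˡ-≡ 2 t c))
                               (s≤s⁻¹ (≤-trans k≤j j≤n)) ⟩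
  leaves i (2 + c) j (2 + c) (1 + c)
    ≡⟨ leaves-at i (2 + c) j (1 + c) refl ⟩
  𝟙[ not (⌊ i ≤? 1 + c ⌋ ∧ ⌊ 1 + c ≤? j ⌋) ]
    ≡⟨ cong 𝟙[_] left-neighbour-outside ⟩
  𝟙[ ⌊ 2 + c ≟ i ⌋ ] ∎
  where
  open ≡-Reasoning
  left-neighbour-outside : not (⌊ i ≤? 1 + c ⌋ ∧ ⌊ 1 + c ≤? j ⌋) ≡ ⌊ 2 + c ≟ i ⌋
  left-neighbour-outside rewrite ⌊⌋-true (1 + c ≤? j) (≤-trans (n≤1+n _) k≤j) with 2 + c ≟ i
  ... | yes refl rewrite ⌊⌋-false (i ≤? 1 + c) (<⇒≱ ≤-refl) = refl
  ... | no k≢i rewrite ⌊⌋-true (i ≤? 1 + c) (s≤s⁻¹ (≤∧≢⇒< i≤k (k≢i ∘ sym))) = refl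

right-path-sum : ∀ {i k j n} → i ≤ suc k → suc k ≤ j → j ≤ n →
  sum (applyUpTo (λ t → leaves i (suc k) j (1 + t) (2 + t)) (n ∸ 1)) ≡ 𝟙[ ⌊ suc k ≟ j ⌋ ∧ ⌊ j <? n ⌋ ]
right-path-sum {n = zero} _ k≤j j≤n with () ← ≤-trans k≤j j≤n
right-path-sum {i} {k} {j} {suc n} i≤k k≤j j≤n with suc k ≟ j
... | no k≢j = sum-applyUpTo-zero _ n inside
  where
  inside : ∀ t → t < n → leaves i (suc k) j (1 + t) (2 + t) ≡ 0
  inside t _ with t ≟ k
  ... | no t≢k = leaves-off i (suc k) j (2 + t) (t≢k ∘ suc-injective)
  ... | yes refl rewrite leaves-at i (suc k) j (2 + t) refl
                      | ⌊⌋-true (i ≤? 2 + t) (≤-trans i≤k (n≤1+n _))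
                      | ⌊⌋-true (2 + t ≤? j) (≤∧≢⇒< k≤j k≢j) = refl
... | yes refl with suc k <? suc n
...   | no k≮n = sum-applyUpTo-zero _ n λ t t<n →
          leaves-off i (suc k) (suc k) (2 + t) λ t+1≡k+1 → k≮n (s≤s (subst (_< n) (suc-injective t+1≡k+1) t<n))
...   | yes k<n = begin
  sum (applyUpTo (λ t → leaves i (suc k) (suc k) (1 + t) (2 + t)) n)
    ≡⟨ sum-applyUpTo-point _ n (λ t t≢k → leaves-off i (suc k) (suc k) (2 + t) (t≢k ∘ suc-injective))
                               (s<s⁻¹ k<n) ⟩
  leaves i (suc k) (suc k) (1 + k) (2 + k)
    ≡⟨ leaves-at i (suc k) (suc k) (2 + k) refl ⟩
  𝟙[ not (⌊ i ≤? 2 + k ⌋ ∧ ⌊ 2 + k ≤? 1 + k ⌋) ]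
    ≡⟨ cong (λ b → 𝟙[ not (⌊ i ≤? 2 + k ⌋ ∧ b) ]) (⌊⌋-false (2 + k ≤? 1 + k) (<⇒≱ ≤-refl)) ⟩
  𝟙[ not (⌊ i ≤? 2 + k ⌋ ∧ false) ]
    ≡⟨ cong (λ b → 𝟙[ not b ]) (∧-zeroʳ _) ⟩
  1 ∎
  where open ≡-Reasoning

d-formula : ∀ {n i k j} → 1 ≤ i → i ≤ k → k ≤ j → j ≤ n →
  d n i k j ≡ suc (𝟙[ ⌊ k ≟ i ⌋ ] + 𝟙[ ⌊ k ≟ j ⌋ ∧ ⌊ j <? n ⌋ ])
d-formula {i = suc (suc _)} {suc zero} _ (s≤s ()) _ _
d-formula {n} {suc zero} {suc zero} {j} _ i≤k k≤j j≤n =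
  trans (d-split 1 1 j n)
        (cong (2 +_) (cong₂ _+_ (spokes-sum-1 0 j (n ∸ 1))
                                (trans (cong₂ _+_ (right-path-sum i≤k k≤j j≤n) (left-path-sum-1 1 j (n ∸ 1))) (+-identityʳ _))))
d-formula {n} {suc i} {suc (suc c)} {j} _ i≤k k≤j j≤n =
  trans (d-split (suc i) (2 + c) j n)
        (trans (cong₂ _+_ (spokes-sum-2+ i c j n (≤-trans k≤j j≤n))
                          (cong₂ _+_ (right-path-sum i≤k k≤j j≤n) (left-path-sum-2+ i≤k k≤j j≤n)))
               (cong suc (+-comm 𝟙[ ⌊ 2 + c ≟ j ⌋ ∧ ⌊ j <? n ⌋ ] _)))

ifZero : ℕ → ℕ → ℕ
ifZero zero    a = a
ifZero (suc _) a = 0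

d-offsets : ∀ {n i j} t u → 1 ≤ i → u + (t + i) ≡ j → j ≤ n →
  d n i (t + i) j ≡ suc (ifZero t 1 + ifZero u 𝟙[ ⌊ j <? n ⌋ ])
d-offsets {n} {i} {j} t u 1≤i u+k≡j j≤n =
  trans (d-formula 1≤i (m≤n+m i t) (subst (t + i ≤_) u+k≡j (m≤n+m (t + i) u)) j≤n)
        (cong suc (cong₂ _+_ (left t) (right u u+k≡j)))
  where
  left : ∀ t → 𝟙[ ⌊ t + i ≟ i ⌋ ] ≡ ifZero t 1
  left zero    rewrite ⌊⌋-true (i ≟ i) refl = refl
  left (suc t) rewrite ⌊⌋-false (suc t + i ≟ i) (m≢1+n+m i ∘ sym) = refl
  right : ∀ {j} u → u + (t + i) ≡ j → 𝟙[ ⌊ t + i ≟ j ⌋ ∧ ⌊ j <? n ⌋ ] ≡ ifZero u 𝟙[ ⌊ j <? n ⌋ ]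
  right zero    refl rewrite ⌊⌋-true (t + i ≟ t + i) refl = refl
  right (suc u) refl rewrite ⌊⌋-false (t + i ≟ suc u + (t + i)) (m≢1+n+m (t + i) {u}) = refl

-- Parking functions and interval bounds

window : (ℕ → ℕ) → ℕ → ℕ → ℕ
window f i zero    = 0
window f i (suc l) = f i + window f (suc i) l

window-+ : ∀ f i l₁ l₂ → window f i (l₁ + l₂) ≡ window f i l₁ + window f (l₁ + i) l₂
window-+ f i zero     l₂ = refl
window-+ f i (suc l₁) l₂ = begin
  f i + window f (suc i) (l₁ + l₂)
    ≡⟨ cong (f i +_) (window-+ f (suc i) l₁ l₂) ⟩
  f i + (window f (suc i) l₁ + window f (l₁ + suc i) l₂)
    ≡⟨ cong (λ x → f i + (window f (suc i) l₁ + window f x l₂)) (+-suc l₁ i) ⟩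
  f i + (window f (suc i) l₁ + window f (suc (l₁ + i)) l₂)
    ≡⟨ sym (+-assoc (f i) _ _) ⟩
  f i + window f (suc i) l₁ + window f (suc (l₁ + i)) l₂ ∎
  where open ≡-Reasoning

ifZero-0 : ∀ t → ifZero t 0 ≡ 0
ifZero-0 zero    = refl
ifZero-0 (suc t) = refl

-- Pigeonhole, with a bonus a at the first and b at the last position.
window-excess : ∀ f l i a b → window f i (suc l) ≤ a + l + b →
  ∃₂ λ t u → t + u ≡ l × f (t + i) ≤ ifZero t a + ifZero u b
window-excess f zero i a b fi≤ =
  0 , 0 , refl , subst₂ _≤_ (+-identityʳ (f i)) (cong (_+ b) (+-identityʳ a)) fi≤
window-excess f (suc l) i a b bound with f i ≤? a
... | yes fi≤a = 0 , suc l , refl , subst (f i ≤_) (sym (+-identityʳ a)) fi≤a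
... | no  fi≰a with window-excess f l (suc i) 0 b rest
  where
  rest : window f (suc i) (suc l) ≤ l + b
  rest = +-cancelˡ-≤ (suc a) _ _ (begin
    suc a + window f (suc i) (suc l) ≤⟨ +-monoˡ-≤ _ (≰⇒> fi≰a) ⟩
    f i + window f (suc i) (suc l)   ≤⟨ bound ⟩
    a + suc l + b                    ≡⟨ cong (_+ b) (+-suc a l) ⟩
    suc a + l + b                    ≡⟨ +-assoc (suc a) l b ⟩
    suc a + (l + b)                  ∎)
    where open ≤-Reasoning
...   | t , u , refl , low =
  suc t , u , refl , subst₂ (λ k e → f k ≤ e + ifZero u b) (+-suc t i) (ifZero-0 t) low

-- IsParking n s unfolds to Parking n (at s).
Parking : ℕ → (ℕ → ℕ) → Set
Parking n f = ∀ i j → 1 ≤ i → i ≤ j → j ≤ n → ∃ λ k → i ≤ k × k ≤ j × f k < d n i k j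

-- By d-offsets: the vertex k = t + i of [i, l + i] has f k < d n i k (l + i).
Burns : ℕ → (ℕ → ℕ) → ℕ → ℕ → Set
Burns n f i l = ∃₂ λ t u → t + u ≡ l × f (t + i) ≤ ifZero t 1 + ifZero u 𝟙[ ⌊ l + i <? n ⌋ ]

AllIntervalsBurn : ℕ → (ℕ → ℕ) → Set
AllIntervalsBurn n f = ∀ i l → 1 ≤ i → l + i ≤ n → Burns n f i l

WindowBound : ℕ → (ℕ → ℕ) → ℕ → Set
WindowBound n f l = ∀ i → 1 ≤ i → l + i ≤ n → window f i (suc l) ≤ suc l + 𝟙[ ⌊ l + i <? n ⌋ ]

IntervalBound : ℕ → (ℕ → ℕ) → Set
IntervalBound n f = ∀ l → WindowBound n f l

m≤n⇒∃[o]o+m≡n : ∀ {m n} → m ≤ n → ∃ λ o → o + m ≡ n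
m≤n⇒∃[o]o+m≡n {m} m≤n with o , m+o≡n ← m≤n⇒∃[o]m+o≡n m≤n = o , trans (+-comm o m) m+o≡n

u+[t+i]≡[t+u]+i : ∀ t u i → u + (t + i) ≡ t + u + i
u+[t+i]≡[t+u]+i = solve-∀

parking⇔burns : ∀ {n f} → Parking n f ⇔ AllIntervalsBurn n f
parking⇔burns {n} {f} = mk⇔ to from
  where
  to : Parking n f → AllIntervalsBurn n f
  to parking i l 1≤i l+i≤n with parking i (l + i) 1≤i (m≤n+m i l) l+i≤n
  ... | k , i≤k , k≤j , fk<d with t , refl ← m≤n⇒∃[o]o+m≡n i≤k | u , u+k≡j ← m≤n⇒∃[o]o+m≡n k≤j =
    t , u , +-cancelʳ-≡ i _ _ (trans (sym (u+[t+i]≡[t+u]+i t u i)) u+k≡j) ,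
    s≤s⁻¹ (subst (f (t + i) <_) (d-offsets t u 1≤i u+k≡j l+i≤n) fk<d)
  from : AllIntervalsBurn n f → Parking n f
  from burns i j 1≤i i≤j j≤n with l , refl ← m≤n⇒∃[o]o+m≡n i≤j with burns i l 1≤i j≤n
  ... | t , u , refl , low =
    t + i , m≤n+m i t , +-monoˡ-≤ i (m≤m+n t u) ,
    subst (f (t + i) <_) (sym (d-offsets t u 1≤i (u+[t+i]≡[t+u]+i t u i) j≤n)) (s≤s low)

-- WindowBound in a form that also covers the empty window.
window-slack : ∀ {n f L} → (∀ {l} → l < L → WindowBound n f l) → ∀ l i → l ≤ L → 1 ≤ i → l + i ≤ suc n →
  window f i l + ifZero l 𝟙[ ⌊ l + i ≤? n ⌋ ] ≤ l + 𝟙[ ⌊ l + i ≤? n ⌋ ]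
window-slack         rec zero    i _   _   _     = ≤-refl
window-slack {n} {f} rec (suc l) i l<L 1≤i l+i≤n =
  subst (_≤ suc l + 𝟙[ ⌊ l + i <? n ⌋ ]) (sym (+-identityʳ (window f i (suc l)))) (rec l<L i 1≤i (s≤s⁻¹ l+i≤n))

module _ {n f} (burns : AllIntervalsBurn n f) where

  bound-from-burns : IntervalBound n f
  bound-from-burns = <-rec (WindowBound n f) step
    where
    step : ∀ l → (∀ {l′} → l′ < l → WindowBound n f l′) → WindowBound n f l
    step l rec i 1≤i l+i≤n with burns i l 1≤i l+i≤n
    ... | t , u , refl , low = begin
      window f i (suc (t + u))
        ≡⟨ cong (window f i) (sym (+-suc t u)) ⟩
      window f i (t + suc u)
        ≡⟨ window-+ f i t (suc u) ⟩
      window f i t + (f (t + i) + W)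
        ≤⟨ +-monoʳ-≤ (window f i t) (+-monoˡ-≤ W low) ⟩
      window f i t + (ifZero t 1 + ifZero u b + W)
        ≡⟨ regroup (window f i t) (ifZero t 1) (ifZero u b) W ⟩
      (window f i t + ifZero t 1) + (W + ifZero u b)
        ≤⟨ +-mono-≤ left right ⟩
      (t + 1) + (u + b)
        ≡⟨ regroup′ t u b ⟩
      suc (t + u) + b ∎
      where
      open ≤-Reasoning
      b = 𝟙[ ⌊ t + u + i <? n ⌋ ]
      W = window f (suc (t + i)) u
      k≤n : t + i ≤ n
      k≤n = ≤-trans (+-monoˡ-≤ i (m≤m+n t u)) l+i≤n
      j≡ : u + suc (t + i) ≡ suc (t + u + i)
      j≡ = trans (+-suc u (t + i)) (cong suc (u+[t+i]≡[t+u]+i t u i))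
      left : window f i t + ifZero t 1 ≤ t + 1
      left = subst (λ c → window f i t + ifZero t c ≤ t + c) (cong 𝟙[_] (⌊⌋-true (t + i ≤? n) k≤n))
                   (window-slack rec t i (m≤m+n t u) 1≤i (m≤n⇒m≤1+n k≤n))
      right : W + ifZero u b ≤ u + b
      right = subst (λ c → W + ifZero u c ≤ u + c) (cong (λ x → 𝟙[ ⌊ x ≤? n ⌋ ]) j≡)
                    (window-slack rec u (suc (t + i)) (m≤n+m u t) (s≤s z≤n) (subst (_≤ suc n) (sym j≡) (s≤s l+i≤n)))
      regroup : ∀ w x y z → w + (x + y + z) ≡ (w + x) + (z + y)
      regroup = solve-∀
      regroup′ : ∀ t u b → (t + 1) + (u + b) ≡ suc (t + u) + b
      regroup′ = solve-∀

burns⇔bound : ∀ {n f} → AllIntervalsBurn n f ⇔ IntervalBound n f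
burns⇔bound {n} {f} = mk⇔ bound-from-burns λ bound i l 1≤i l+i≤n → window-excess f l i 1 _ (bound l i 1≤i l+i≤n)

parking⇔bound : ∀ {n f} → Parking n f ⇔ IntervalBound n f
parking⇔bound = ⇔-trans parking⇔burns burns⇔bound

-- Prefix sums

prefix : (ℕ → ℕ) → ℕ → ℕ
prefix f = window f 1

prefix-+ : ∀ f k l → prefix f (k + l) ≡ prefix f k + window f (suc k) l
prefix-+ f k l = trans (window-+ f 1 k l) (cong (λ i → prefix f k + window f i l) (+-comm k 1))

-- The carry c is the excess P(k) − k left by entries already removed in front.
Staircase : Bool → (ℕ → ℕ) → ℕ → Set
Staircase c f n =
  (∀ k → k < n → k ≤ 𝟙[ c ] + prefix f k × 𝟙[ c ] + prefix f k ≤ suc k) × 𝟙[ c ] + prefix f n ≡ n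

𝟙-≤1 : ∀ b → 𝟙[ b ] ≤ 1
𝟙-≤1 false = z≤n
𝟙-≤1 true  = ≤-refl

module _ {n f} (bound : IntervalBound n f) where

  prefix-lower : prefix f n ≡ n → ∀ k → k < n → k ≤ prefix f k
  prefix-lower total k k<n with r , r+1+k≡n ← m≤n⇒∃[o]o+m≡n k<n = +-cancelʳ-≤ (suc r) k (prefix f k) (begin
    k + suc r                                  ≡⟨ n≡ ⟩
    n                                          ≡⟨ sym total ⟩
    prefix f n                                 ≡⟨ cong (prefix f) (sym n≡) ⟩
    prefix f (k + suc r)                       ≡⟨ prefix-+ f k (suc r) ⟩
    prefix f k + window f (suc k) (suc r)      ≤⟨ +-monoʳ-≤ (prefix f k) suffix ⟩
    prefix f k + suc r                         ∎)
    where
    open ≤-Reasoning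
    n≡ : k + suc r ≡ n
    n≡ = trans (+-comm k (suc r)) (trans (sym (+-suc r k)) r+1+k≡n)
    suffix : window f (suc k) (suc r) ≤ suc r
    suffix = ≤-trans (bound r (suc k) (s≤s z≤n) (≤-reflexive r+1+k≡n))
                     (≤-reflexive (trans (cong (λ b → suc r + 𝟙[ b ]) (⌊⌋-false (r + suc k <? n) (<-irrefl r+1+k≡n)))
                                         (+-identityʳ (suc r))))

  prefix-upper : ∀ k → k < n → prefix f k ≤ suc k
  prefix-upper zero    _   = z≤n
  prefix-upper (suc k) k<n = ≤-trans (bound k 1 (s≤s z≤n) (subst (_≤ n) (+-comm 1 k) (<⇒≤ k<n)))
                                     (≤-trans (+-monoʳ-≤ (suc k) (𝟙-≤1 _)) (≤-reflexive (+-comm (suc k) 1)))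

  staircase-from-bound : prefix f n ≡ n → Staircase false f n
  staircase-from-bound total = (λ k k<n → prefix-lower total k k<n , prefix-upper k k<n) , total

module _ {n f} (staircase : Staircase false f n) where

  prefix-at-end : ∀ j → j ≤ n → prefix f j ≤ j + 𝟙[ ⌊ j <? n ⌋ ]
  prefix-at-end j j≤n with j <? n
  ... | yes j<n = subst (prefix f j ≤_) (+-comm 1 j) (proj₂ (proj₁ staircase j j<n))
  ... | no  j≮n rewrite ≤-antisym j≤n (≮⇒≥ j≮n) = ≤-reflexive (trans (proj₂ staircase) (sym (+-identityʳ n)))

  bound-from-staircase : IntervalBound n f
  bound-from-staircase l (suc i) _ l+i≤n = +-cancelˡ-≤ i _ _ (begin
    i + window f (suc i) (suc l)              ≤⟨ +-monoˡ-≤ _ (proj₁ (proj₁ staircase i (≤-trans (m≤n+m (suc i) l) l+i≤n))) ⟩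
    prefix f i + window f (suc i) (suc l)     ≡⟨ sym (prefix-+ f i (suc l)) ⟩
    prefix f (i + suc l)                      ≡⟨ cong (prefix f) j≡ ⟩
    prefix f (l + suc i)                      ≤⟨ prefix-at-end (l + suc i) l+i≤n ⟩
    l + suc i + 𝟙[ ⌊ l + suc i <? n ⌋ ]       ≡⟨ cong (_+ 𝟙[ ⌊ l + suc i <? n ⌋ ]) (sym j≡) ⟩
    i + suc l + 𝟙[ ⌊ l + suc i <? n ⌋ ]       ≡⟨ +-assoc i (suc l) _ ⟩
    i + (suc l + 𝟙[ ⌊ l + suc i <? n ⌋ ])     ∎)
    where
    open ≤-Reasoning
    j≡ : i + suc l ≡ l + suc i
    j≡ = trans (+-suc i l) (trans (cong suc (+-comm i l)) (sym (+-suc l i)))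

bound⇔staircase : ∀ {n f} → (IntervalBound n f × prefix f n ≡ n) ⇔ Staircase false f n
bound⇔staircase = mk⇔ (λ (bound , total) → staircase-from-bound bound total)
                      (λ staircase → bound-from-staircase staircase , proj₂ staircase)

window-at-∷ : ∀ {m} x (xs : Vec ℕ m) i l → window (at (x ∷ xs)) (2 + i) l ≡ window (at xs) (suc i) l
window-at-∷ x xs i zero    = refl
window-at-∷ x xs i (suc l) = cong (at xs (suc i) +_) (window-at-∷ x xs (suc i) l)

prefix-∷ : ∀ {m} x (xs : Vec ℕ m) k → prefix (at (x ∷ xs)) (suc k) ≡ x + prefix (at xs) k
prefix-∷ x xs k = cong (x +_) (window-at-∷ x xs 0 k)

sum≡prefix : ∀ {n} (s : Vec ℕ n) → V.sum s ≡ prefix (at s) n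
sum≡prefix []       = refl
sum≡prefix {suc n} (x ∷ xs) = trans (cong (x +_) (sum≡prefix xs)) (sym (prefix-∷ x xs n))

smax⇔staircase : ∀ {n} (s : Vec ℕ n) → InSmax n s ⇔ Staircase false (at s) n
smax⇔staircase s =
  ⇔-trans (parking⇔bound ×-⇔ mk⇔ (trans (sym (sum≡prefix s))) (trans (sum≡prefix s))) bound⇔staircase

-- The excess before and after an entry x, which itself adds x − 1.
Carry : Bool → ℕ → Bool → Set
Carry c x c′ = 𝟙[ c ] + x ≡ suc 𝟙[ c′ ]

carry-shift : ∀ {m} c c′ x (xs : Vec ℕ m) → Carry c x c′ → ∀ k →
  𝟙[ c ] + prefix (at (x ∷ xs)) (suc k) ≡ suc (𝟙[ c′ ] + prefix (at xs) k)
carry-shift c c′ x xs carry k =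
  trans (cong (𝟙[ c ] +_) (prefix-∷ x xs k)) (trans (sym (+-assoc 𝟙[ c ] x _)) (cong (_+ prefix (at xs) k) carry))

staircase-start : ∀ c f → 0 ≤ 𝟙[ c ] + prefix f 0 × 𝟙[ c ] + prefix f 0 ≤ 1
staircase-start c f = z≤n , subst (_≤ 1) (sym (+-identityʳ 𝟙[ c ])) (𝟙-≤1 c)

staircase-[] : ∀ {c x} → Staircase c (at (x ∷ [])) 1 ⇔ Carry c x false
staircase-[] {c} {x} = mk⇔
  (λ (_ , total) → trans (cong (𝟙[ c ] +_) (sym (+-identityʳ x))) total)
  (λ carry → (λ { zero _ → staircase-start c (at (x ∷ [])) ; (suc _) (s≤s ()) })
           , trans (cong (𝟙[ c ] +_) (+-identityʳ x)) carry)

staircase-∷⁺ : ∀ {m c c′ x} {xs : Vec ℕ (suc m)} → Carry c x c′ → Staircase c′ (at xs) (suc m) →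
  Staircase c (at (x ∷ xs)) (2 + m)
staircase-∷⁺ {m} {c} {c′} {x} {xs} carry (bounds , total) =
  bounds′ , trans (carry-shift c c′ x xs carry (suc m)) (cong suc total)
  where
  bounds′ : ∀ k → k < 2 + m → k ≤ 𝟙[ c ] + prefix (at (x ∷ xs)) k × 𝟙[ c ] + prefix (at (x ∷ xs)) k ≤ suc k
  bounds′ zero    _         = staircase-start c (at (x ∷ xs))
  bounds′ (suc k) (s<s k<n) with lower , upper ← bounds k k<n =
    subst (suc k ≤_) (sym (carry-shift c c′ x xs carry k)) (s≤s lower) ,
    subst (_≤ 2 + k) (sym (carry-shift c c′ x xs carry k)) (s≤s upper)

between-1-2 : ∀ {y} → 1 ≤ y → y ≤ 2 → ∃ λ c → y ≡ suc 𝟙[ c ]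
between-1-2 {1} _ _ = false , refl
between-1-2 {2} _ _ = true , refl
between-1-2 {suc (suc (suc _))} _ (s≤s (s≤s ()))

staircase-∷⁻ : ∀ {m c x} {xs : Vec ℕ (suc m)} → Staircase c (at (x ∷ xs)) (2 + m) →
  ∃ λ c′ → Carry c x c′ × Staircase c′ (at xs) (suc m)
staircase-∷⁻ {m} {c} {x} {xs} (bounds , total)
  with c′ , first≡ ← uncurry between-1-2 (bounds 1 (s<s z<s)) =
    c′ , carry , bounds′ , suc-injective (trans (sym (carry-shift c c′ x xs carry (suc m))) total)
  where
  carry : Carry c x c′
  carry = trans (cong (𝟙[ c ] +_) (sym (+-identityʳ x))) first≡
  bounds′ : ∀ k → k < suc m → k ≤ 𝟙[ c′ ] + prefix (at xs) k × 𝟙[ c′ ] + prefix (at xs) k ≤ suc k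
  bounds′ k k<n with lower , upper ← bounds (suc k) (s<s k<n) =
    s≤s⁻¹ (subst (suc k ≤_) (carry-shift c c′ x xs carry k) lower) ,
    s≤s⁻¹ (subst (_≤ 2 + k) (carry-shift c c′ x xs carry k) upper)

-- Decompositions into unit vectors

tabulate-const : ∀ {n} (x : ℕ) → tabulate {n = n} (λ _ → x) ≡ replicate n x
tabulate-const {zero}  x = refl
tabulate-const {suc n} x = cong (x ∷_) (tabulate-const x)

e-suc : ∀ {n} (i : Fin n) → e (suc i) ≡ 0 ∷ e i
e-suc i = cong (0 ∷_) (tabulate-cong tests-agree)
  where
  tests-agree : ∀ j → (if ⌊ suc i ≟ᶠ suc j ⌋ then 1 else 0) ≡ (if ⌊ i ≟ᶠ j ⌋ then 1 else 0)
  tests-agree j with i ≟ᶠ j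
  ... | yes _ = refl
  ... | no  _ = refl

-- With carry true the unit e₁ has already been used up.
initial : ∀ {n} → Bool → Vec ℕ (suc n)
initial false = e zero
initial true  = replicate _ 0

initial-∷ : ∀ {n} c → initial {n} c ≡ 𝟙[ not c ] ∷ replicate n 0
initial-∷ false = cong (1 ∷_) (tabulate-const 0)
initial-∷ true  = refl

choose : ∀ {n} → Bool → Vec ℕ (2 + n)
choose true  = e zero
choose false = e (suc zero)

choose-∷ : ∀ {n} c → choose {n} c ≡ 𝟙[ c ] ∷ initial c
choose-∷ true  = cong (1 ∷_) (tabulate-const 0)
choose-∷ false = e-suc zero

initial-choose : ∀ {n} c c′ (w : Vec ℕ (suc n)) →
  initial c ⊕ (choose c′ ⊕ (0 ∷ w)) ≡ (𝟙[ not c ] + 𝟙[ c′ ]) ∷ (initial c′ ⊕ w)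
initial-choose {n} c c′ w rewrite choose-∷ {n} c′ | initial-∷ {suc n} c =
  cong₂ _∷_ (cong (𝟙[ not c ] +_) (+-identityʳ 𝟙[ c′ ])) (zipWith-identityˡ +-identityˡ (initial c′ ⊕ w))

carry⇒ : ∀ {c x c′} → Carry c x c′ → x ≡ 𝟙[ not c ] + 𝟙[ c′ ]
carry⇒ {false} eq = eq
carry⇒ {true}  eq = suc-injective eq

carry⇐ : ∀ {c x c′} → x ≡ 𝟙[ not c ] + 𝟙[ c′ ] → Carry c x c′
carry⇐ {false} eq = eq
carry⇐ {true}  eq = cong suc eq

vsum-cong : ∀ {m n} {a b : Fin m → Vec ℕ n} → (∀ j → a j ≡ b j) → vsum a ≡ vsum b
vsum-cong {zero}  a≡b = refl
vsum-cong {suc m} a≡b = cong₂ _⊕_ (a≡b zero) (vsum-cong (a≡b ∘ suc))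

vsum-0∷ : ∀ {m n} (w : Fin m → Vec ℕ n) → vsum (λ j → 0 ∷ w j) ≡ 0 ∷ vsum w
vsum-0∷ {zero}  w = refl
vsum-0∷ {suc m} w = cong ((0 ∷ w zero) ⊕_) (vsum-0∷ (w ∘ suc))

Admissible : ∀ {m} → (Fin m → Vec ℕ (suc m)) → Set
Admissible a = ∀ j → (a j ≡ e (inject₁ j)) ⊎ (a j ≡ e (suc j))

Decomposition : ∀ m → Bool → Vec ℕ (suc m) → Set
Decomposition m c v = Σ (Fin m → Vec ℕ (suc m)) λ a → Admissible a × (v ≡ initial c ⊕ vsum a)

≡e-suc : ∀ {n} {v : Vec ℕ (suc n)} {i} → v ≡ e (suc i) → v ≡ 0 ∷ tail v × tail v ≡ e i
≡e-suc {i = i} refl = refl , cong tail (e-suc i)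

admissible-tail : ∀ {m} {a : Fin (suc m) → Vec ℕ (2 + m)} → Admissible a →
  Admissible (tail ∘ a ∘ suc) × (∀ j → a (suc j) ≡ 0 ∷ tail (a (suc j)))
admissible-tail adm = (λ j → Sum.map (proj₂ ∘ ≡e-suc) (proj₂ ∘ ≡e-suc) (adm (suc j)))
                    , (λ j → Sum.[ proj₁ ∘ ≡e-suc , proj₁ ∘ ≡e-suc ] (adm (suc j)))

choice : ∀ {n} {v : Vec ℕ (2 + n)} → (v ≡ e zero) ⊎ (v ≡ e (suc zero)) → ∃ λ c → v ≡ choose c
choice (inj₁ v≡) = true  , v≡
choice (inj₂ v≡) = false , v≡

choose-admissible : ∀ {n} c → (choose {n} c ≡ e zero) ⊎ (choose {n} c ≡ e (suc zero))
choose-admissible true  = inj₁ refl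
choose-admissible false = inj₂ refl

decomposition-[] : ∀ {c x} → Decomposition 0 c (x ∷ []) ⇔ Carry c x false
decomposition-[] {c} = mk⇔
  (λ (_ , _ , eq) → carry⇐ (∷-injectiveˡ (trans eq (cong (_⊕ (0 ∷ [])) (initial-∷ c)))))
  (λ carry → (λ ()) , (λ ()) , trans (cong (_∷ []) (carry⇒ carry)) (sym (cong (_⊕ (0 ∷ [])) (initial-∷ c))))

decomposition-∷⁻ : ∀ {m c x} {xs : Vec ℕ (suc m)} → Decomposition (suc m) c (x ∷ xs) →
  ∃ λ c′ → Carry c x c′ × Decomposition m c′ xs
decomposition-∷⁻ {m} {c} {x} {xs} (a , adm , eq) with c′ , a₀≡ ← choice (adm zero) =
  c′ , carry⇐ (∷-injectiveˡ eq′) , tail ∘ a ∘ suc , proj₁ (admissible-tail adm) , ∷-injectiveʳ eq′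
  where
  open ≡-Reasoning
  eq′ : x ∷ xs ≡ (𝟙[ not c ] + 𝟙[ c′ ]) ∷ (initial c′ ⊕ vsum (tail ∘ a ∘ suc))
  eq′ = begin
    x ∷ xs
      ≡⟨ eq ⟩
    initial c ⊕ (a zero ⊕ vsum (a ∘ suc))
      ≡⟨ cong₂ (λ u w → initial c ⊕ (u ⊕ w)) a₀≡
               (trans (vsum-cong (proj₂ (admissible-tail adm))) (vsum-0∷ (tail ∘ a ∘ suc))) ⟩
    initial c ⊕ (choose c′ ⊕ (0 ∷ vsum (tail ∘ a ∘ suc)))
      ≡⟨ initial-choose c c′ _ ⟩
    (𝟙[ not c ] + 𝟙[ c′ ]) ∷ (initial c′ ⊕ vsum (tail ∘ a ∘ suc)) ∎

decomposition-∷⁺ : ∀ {m c x c′} {xs : Vec ℕ (suc m)} → Carry c x c′ → Decomposition m c′ xs →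
  Decomposition (suc m) c (x ∷ xs)
decomposition-∷⁺ {m} {c} {x} {c′} {xs} carry (a′ , adm′ , eq) = a , adm , (begin
  x ∷ xs
    ≡⟨ cong₂ _∷_ (carry⇒ carry) eq ⟩
  (𝟙[ not c ] + 𝟙[ c′ ]) ∷ (initial c′ ⊕ vsum a′)
    ≡⟨ sym (initial-choose c c′ (vsum a′)) ⟩
  initial c ⊕ (choose c′ ⊕ (0 ∷ vsum a′))
    ≡⟨ cong (λ w → initial c ⊕ (choose c′ ⊕ w)) (sym (vsum-0∷ a′)) ⟩
  initial c ⊕ vsum a ∎)
  where
  open ≡-Reasoning
  a : Fin (suc m) → Vec ℕ (2 + m)
  a zero    = choose c′
  a (suc j) = 0 ∷ a′ j
  adm : Admissible a
  adm zero    = choose-admissible c′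
  adm (suc j) = Sum.map (0∷≡e-suc ∘ cong (0 ∷_)) (0∷≡e-suc ∘ cong (0 ∷_)) (adm′ j)
    where
    0∷≡e-suc : ∀ {v : Vec ℕ (2 + m)} {i} → v ≡ 0 ∷ e i → v ≡ e (suc i)
    0∷≡e-suc p = trans p (sym (e-suc _))

decomposition⇔staircase : ∀ m c (v : Vec ℕ (suc m)) → Decomposition m c v ⇔ Staircase c (at v) (suc m)
decomposition⇔staircase zero    c (x ∷ [])  = ⇔-trans decomposition-[] (⇔-sym staircase-[])
decomposition⇔staircase (suc m) c (x ∷ xs) = mk⇔
  (λ dec → let c′ , carry , dec′ = decomposition-∷⁻ dec
           in staircase-∷⁺ carry (Equivalence.to (decomposition⇔staircase m c′ xs) dec′))
  (λ st  → let c′ , carry , st′ = staircase-∷⁻ st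
           in decomposition-∷⁺ carry (Equivalence.from (decomposition⇔staircase m c′ xs) st′))

corollary2 : (m : ℕ) → (s : Vec ℕ (suc m)) →
    (InSmax (suc m) s →
      Σ (Fin m → Vec ℕ (suc m)) λ a →
        (∀ j → (a j ≡ e (inject₁ j)) ⊎ (a j ≡ e (suc j))) × (s ≡ e zero ⊕ vsum a))
    × ((Σ (Fin m → Vec ℕ (suc m)) λ a →
        (∀ j → (a j ≡ e (inject₁ j)) ⊎ (a j ≡ e (suc j))) × (s ≡ e zero ⊕ vsum a))
      → InSmax (suc m) s)
corollary2 m s = Equivalence.to smax⇔decomposition , Equivalence.from smax⇔decomposition
  where
  smax⇔decomposition : InSmax (suc m) s ⇔ Decomposition m false s
  smax⇔decomposition = ⇔-trans (smax⇔staircase s) (⇔-sym (decomposition⇔staircase m false s))
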